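{- Let $1 \leq k \leq n$ be integers. Then $F(n,k) \leq S\left(4^{k-1},\binom{n}{k}\right)$.
   Context: $Q_n$ is the $n$-dimensional Boolean hypercube with vertex set $\{ -1,1\}^n$, two vertices being adjacent iff they differ in exactly one coordinate; $\Gamma(x)$ denotes the neighbourhood of $x$. A Boolean function on $Q_n$ is a function $f:\{ -1,1\}^n\to\{ -1,1\}$. A $k$-function is a Boolean function $f$ on $Q_n$ such that for every vertex $v$, $|\{w\in\Gamma(v): f(v)\neq f(w)\}|=k$. $F(n,k)$ denotes the number of $k$-functions on $Q_n$. For integers $q,t\ge 0$, $S(q,t)$ denotes the number of $x\in\mathbb{Z}^t$ with $\sum_{i=1}^t x_i^2=q$. -}

module Defs where

open import Data.Bool using (Bool; true; false; not)
open import Data.Nat using (ℕ; zero; suc; _+_; _*_)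
open import Data.Integer as ℤ using (ℤ; +_; -[1+_])
open import Data.Fin using (Fin; zero; suc)
open import Data.Vec using (Vec; []; _∷_; lookup; updateAt; foldr)
open import Data.List as List using (List; []; _∷_; length; filter; concatMap; map; allFin)
open import Relation.Binary.PropositionalEquality using (_≡_; _≢_)
open import Relation.Nullary using (¬_)
open import Relation.Nullary.Decidable using (¬?)
open import Relation.Unary using (Decidable)
import Data.Bool.Properties as BoolP
open import Data.List.Relation.Unary.All as All using (All)
import Data.Nat.Properties as ℕP
import Data.Integer.Properties as ℤP

-- Vertices of Q_n: Boolean vectors (true ↔ 1, false ↔ -1).
Vertex : ℕ → Set
Vertex n = Vec Bool n

flip : ∀ {n} → Fin n → Vertex n → Vertex n
flip i v = updateAt v i not

BoolFun : ℕ → Set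
BoolFun n = Vertex n → Bool

allVertices : (n : ℕ) → List (Vertex n)
allVertices zero = [] ∷ []
allVertices (suc n) = concatMap (λ v → (false ∷ v) ∷ (true ∷ v) ∷ []) (allVertices n)

-- All Boolean functions on Q_n (each exactly once, up to pointwise equality):
-- a function on Q_{n+1} is a pair of functions on Q_n (by the first coordinate).
allBoolFuns : (n : ℕ) → List (BoolFun n)
allBoolFuns zero = (λ _ → false) ∷ (λ _ → true) ∷ []
allBoolFuns (suc n) =
  concatMap (λ g → map (λ h → λ { (false ∷ v) → g v ; (true ∷ v) → h v }) (allBoolFuns n))
            (allBoolFuns n)

-- Number of neighbours w of v with f v ≠ f w
-- (the neighbours of v are exactly flip i v for i : Fin n, pairwise distinct).
disagreeCount : ∀ {n} → BoolFun n → Vertex n → ℕ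
disagreeCount {n} f v = length (filter (λ i → ¬? (f v BoolP.≟ f (flip i v))) (allFin n))

IsKFunction : (n k : ℕ) → BoolFun n → Set
IsKFunction n k f = ∀ (v : Vertex n) → disagreeCount f v ≡ k

IsKFunctionOn : (n k : ℕ) → BoolFun n → Set
IsKFunctionOn n k f = All (λ v → disagreeCount f v ≡ k) (allVertices n)

isKFunction? : (n k : ℕ) → Decidable (IsKFunctionOn n k)
isKFunction? n k f = All.all? (λ v → disagreeCount f v ℕP.≟ k) (allVertices n)

F : ℕ → ℕ → ℕ
F n k = length (filter (isKFunction? n k) (allBoolFuns n))

intRange : ℕ → List ℤ
intRange q = + 0 ∷ concatMap (λ j → + (suc j) ∷ -[1+ j ] ∷ []) (List.upTo q)

boxVecs : ℕ → (t : ℕ) → List (Vec ℤ t)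
boxVecs q zero = [] ∷ []
boxVecs q (suc t) = concatMap (λ a → map (a ∷_) (boxVecs q t)) (intRange q)

sumSq : ∀ {t} → Vec ℤ t → ℤ
sumSq = foldr _ (λ a s → a ℤ.* a ℤ.+ s) (+ 0)

-- S(q,t): the number of x ∈ ℤ^t with Σ x_i² = q.  Every such x has |x_i| ≤ q,
-- so it suffices to count inside the box [-q,q]^t.
S : ℕ → ℕ → ℕ
S q t = length (filter (λ x → sumSq x ℤP.≟ + q) (boxVecs q t))

module Submission where

open import Defs
open import Data.Nat using (ℕ; _≤_; _∸_; _^_)
open import Data.Nat.Combinatorics using (_C_)

open import Data.Nat as ℕ using (zero; suc; _+_; z≤n; s≤s)
import Data.Nat.Properties as ℕP
open import Data.Nat.Combinatorics using (nCk+nC[k+1]≡[n+1]C[k+1])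
open import Data.Integer as ℤ using (ℤ; +_; -[1+_]; ∣_∣)
import Data.Integer.Properties as ℤP
open import Data.Integer.Tactic.RingSolver using (solve-∀)
import Data.Nat.Tactic.RingSolver as ℕSolver
open import Algebra.Properties.CommutativeSemigroup ℤP.+-commutativeSemigroup using (interchange)
open import Data.Bool using (Bool; true; false)
open import Data.Bool.Properties using (_≟_)
open import Data.Vec as Vec using (Vec; []; _∷_)
import Data.Vec.Properties as VecP
open import Data.List as List
  using (List; []; _∷_; length; filter; map; concatMap; _++_; tabulate; allFin; cartesianProductWith)
import Data.List.Properties as ListP
open import Data.List.Membership.Propositional using (_∈_)
open import Data.List.Membership.Propositional.Properties
  using (∈-∃++; ∈-++⁻; ∈-++⁺ˡ; ∈-++⁺ʳ; ∈-concatMap⁺; ∈-map⁺; ∈-upTo⁺; ∈-filter⁺; ∈-filter⁻)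
open import Data.List.Relation.Unary.Any as Any using (here; there)
open import Data.List.Relation.Unary.All as All using ([]; _∷_)
open import Data.List.Relation.Unary.AllPairs using ([]; _∷_)
open import Data.List.Relation.Unary.Unique.Setoid using (Unique)
import Data.List.Relation.Unary.Unique.Setoid.Properties as UniqueP
open import Data.Product using (_×_; _,_; proj₁; proj₂; ∃-syntax)
open import Data.Product.Properties using (,-injective)
open import Data.Sum using (_⊎_; inj₁; inj₂)
open import Data.Unit using (⊤; tt)
open import Data.Empty using (⊥-elim)
open import Function using (_∘_; case_of_)
open import Level using (Level)
open import Relation.Binary using (Setoid)
open import Relation.Nullary using (yes; no)
open import Relation.Nullary.Decidable using (¬?)
open import Relation.Binary.PropositionalEquality

-- Let σ = (−1)^f, viewed as an integer function on Q_n.  If f is a k-function,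
-- σ is an eigenvector of the adjacency operator for the eigenvalue n − 2k, so its
-- Walsh–Hadamard transform σ̂ lives on the C(n,k) sets of size k.  Hence the 0/1
-- function 1_f = (1 − σ)/2 has Fourier degree at most k, and an integer function of
-- Fourier degree at most k has all transform values divisible by 2^(n−k); so
-- σ̂ = 2^n·δ − 2·1̂_f = 2^(n−k+1)·y with y an integer vector on the k-sets.  Parseval
-- gives ‖σ̂‖² = 4^n, so ‖y‖² = 4^(k−1), and f ↦ y is injective because the
-- transform is.

-- Integer functions on Q_n, as complete binary trees branching on the first
-- coordinate (left: false).
IntFun : ℕ → Set
IntFun zero    = ℤ
IntFun (suc n) = IntFun n × IntFun n

infixl 6 _⊞_ _⊟_
infixr 7 _⊙_

_⊞_ _⊟_ : ∀ {n} → IntFun n → IntFun n → IntFun n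
_⊞_ {zero}  a b = a ℤ.+ b
_⊞_ {suc n} (a , b) (c , d) = a ⊞ c , b ⊞ d
_⊟_ {zero}  a b = a ℤ.- b
_⊟_ {suc n} (a , b) (c , d) = a ⊟ c , b ⊟ d

_⊙_ : ∀ {n} → ℤ → IntFun n → IntFun n
_⊙_ {zero}  c a       = c ℤ.* a
_⊙_ {suc n} c (a , b) = c ⊙ a , c ⊙ b

𝟘 𝟙 δ : ∀ {n} → IntFun n
𝟘 {zero}  = + 0
𝟘 {suc n} = 𝟘 , 𝟘
𝟙 {zero}  = + 1
𝟙 {suc n} = 𝟙 , 𝟙
δ {zero}  = + 1
δ {suc n} = δ , 𝟘

⊞-interchange : ∀ {n} (p q r s : IntFun n) → (p ⊞ q) ⊞ (r ⊞ s) ≡ (p ⊞ r) ⊞ (q ⊞ s)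
⊞-interchange {zero}  = interchange
⊞-interchange {suc n} (p , p′) (q , q′) (r , r′) (s , s′) =
  cong₂ _,_ (⊞-interchange p q r s) (⊞-interchange p′ q′ r′ s′)

⊟-⊞-interchange : ∀ {n} (p q r s : IntFun n) → (p ⊞ q) ⊟ (r ⊞ s) ≡ (p ⊟ r) ⊞ (q ⊟ s)
⊟-⊞-interchange {zero}  = leaf
  where leaf : ∀ (p q r s : ℤ) → (p ℤ.+ q) ℤ.- (r ℤ.+ s) ≡ (p ℤ.- r) ℤ.+ (q ℤ.- s)
        leaf = solve-∀
⊟-⊞-interchange {suc n} (p , p′) (q , q′) (r , r′) (s , s′) =
  cong₂ _,_ (⊟-⊞-interchange p q r s) (⊟-⊞-interchange p′ q′ r′ s′)

⊟-interchange : ∀ {n} (p q r s : IntFun n) → (p ⊟ q) ⊟ (r ⊟ s) ≡ (p ⊟ r) ⊟ (q ⊟ s)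
⊟-interchange {zero}  = leaf
  where leaf : ∀ (p q r s : ℤ) → (p ℤ.- q) ℤ.- (r ℤ.- s) ≡ (p ℤ.- r) ℤ.- (q ℤ.- s)
        leaf = solve-∀
⊟-interchange {suc n} (p , p′) (q , q′) (r , r′) (s , s′) =
  cong₂ _,_ (⊟-interchange p q r s) (⊟-interchange p′ q′ r′ s′)

⊙-distrib-⊞ : ∀ {n} c (p q : IntFun n) → c ⊙ (p ⊞ q) ≡ c ⊙ p ⊞ c ⊙ q
⊙-distrib-⊞ {zero}  = ℤP.*-distribˡ-+
⊙-distrib-⊞ {suc n} c (p , p′) (q , q′) = cong₂ _,_ (⊙-distrib-⊞ c p q) (⊙-distrib-⊞ c p′ q′)

⊙-distrib-⊟ : ∀ {n} c (p q : IntFun n) → c ⊙ (p ⊟ q) ≡ c ⊙ p ⊟ c ⊙ q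
⊙-distrib-⊟ {zero}  = leaf
  where leaf : ∀ (c p q : ℤ) → c ℤ.* (p ℤ.- q) ≡ c ℤ.* p ℤ.- c ℤ.* q
        leaf = solve-∀
⊙-distrib-⊟ {suc n} c (p , p′) (q , q′) = cong₂ _,_ (⊙-distrib-⊟ c p q) (⊙-distrib-⊟ c p′ q′)

⊙-assoc : ∀ {n} a b (p : IntFun n) → a ⊙ b ⊙ p ≡ (a ℤ.* b) ⊙ p
⊙-assoc {zero}  a b p       = sym (ℤP.*-assoc a b p)
⊙-assoc {suc n} a b (p , q) = cong₂ _,_ (⊙-assoc a b p) (⊙-assoc a b q)

⊙-identityˡ : ∀ {n} (p : IntFun n) → + 1 ⊙ p ≡ p
⊙-identityˡ {zero}  = ℤP.*-identityˡ
⊙-identityˡ {suc n} (p , q) = cong₂ _,_ (⊙-identityˡ p) (⊙-identityˡ q)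

⊙-zeroʳ : ∀ {n} c → c ⊙ 𝟘 ≡ 𝟘 {n}
⊙-zeroʳ {zero}  = ℤP.*-zeroʳ
⊙-zeroʳ {suc n} c = cong₂ _,_ (⊙-zeroʳ c) (⊙-zeroʳ c)

⊙-cancelˡ : ∀ {n} c .{{_ : ℤ.NonZero c}} (p q : IntFun n) → c ⊙ p ≡ c ⊙ q → p ≡ q
⊙-cancelˡ {zero}  c p q = ℤP.*-cancelˡ-≡ c p q
⊙-cancelˡ {suc n} c (p , p′) (q , q′) eq =
  cong₂ _,_ (⊙-cancelˡ c p q (proj₁ (,-injective eq))) (⊙-cancelˡ c p′ q′ (proj₂ (,-injective eq)))

⊙≡𝟘 : ∀ {n} c .{{_ : ℤ.NonZero c}} (p : IntFun n) → c ⊙ p ≡ 𝟘 → p ≡ 𝟘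
⊙≡𝟘 c p eq = ⊙-cancelˡ c p 𝟘 (trans eq (sym (⊙-zeroʳ c)))

⊟-self : ∀ {n} (p : IntFun n) → p ⊟ p ≡ 𝟘
⊟-self {zero}  = ℤP.+-inverseʳ
⊟-self {suc n} (p , q) = cong₂ _,_ (⊟-self p) (⊟-self q)

⊞-self : ∀ {n} (p : IntFun n) → p ⊞ p ≡ + 2 ⊙ p
⊞-self {zero}  = leaf
  where leaf : ∀ (p : ℤ) → p ℤ.+ p ≡ + 2 ℤ.* p
        leaf = solve-∀
⊞-self {suc n} (p , q) = cong₂ _,_ (⊞-self p) (⊞-self q)

[p⊞q]⊞[p⊟q]≡2⊙p : ∀ {n} (p q : IntFun n) → (p ⊞ q) ⊞ (p ⊟ q) ≡ + 2 ⊙ p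
[p⊞q]⊞[p⊟q]≡2⊙p {zero}  = leaf
  where leaf : ∀ (p q : ℤ) → (p ℤ.+ q) ℤ.+ (p ℤ.- q) ≡ + 2 ℤ.* p
        leaf = solve-∀
[p⊞q]⊞[p⊟q]≡2⊙p {suc n} (p , p′) (q , q′) =
  cong₂ _,_ ([p⊞q]⊞[p⊟q]≡2⊙p p q) ([p⊞q]⊞[p⊟q]≡2⊙p p′ q′)

[p⊞q]⊟[p⊟q]≡2⊙q : ∀ {n} (p q : IntFun n) → (p ⊞ q) ⊟ (p ⊟ q) ≡ + 2 ⊙ q
[p⊞q]⊟[p⊟q]≡2⊙q {zero}  = leaf
  where leaf : ∀ (p q : ℤ) → (p ℤ.+ q) ℤ.- (p ℤ.- q) ≡ + 2 ℤ.* q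
        leaf = solve-∀
[p⊞q]⊟[p⊟q]≡2⊙q {suc n} (p , p′) (q , q′) =
  cong₂ _,_ ([p⊞q]⊟[p⊟q]≡2⊙q p q) ([p⊞q]⊟[p⊟q]≡2⊙q p′ q′)

p⊞q≡[p⊟q]⊞2⊙q : ∀ {n} (p q : IntFun n) → p ⊞ q ≡ (p ⊟ q) ⊞ + 2 ⊙ q
p⊞q≡[p⊟q]⊞2⊙q {zero}  = leaf
  where leaf : ∀ (p q : ℤ) → p ℤ.+ q ≡ (p ℤ.- q) ℤ.+ + 2 ℤ.* q
        leaf = solve-∀
p⊞q≡[p⊟q]⊞2⊙q {suc n} (p , p′) (q , q′) =
  cong₂ _,_ (p⊞q≡[p⊟q]⊞2⊙q p q) (p⊞q≡[p⊟q]⊞2⊙q p′ q′)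

p⊟[p⊟q]≡q : ∀ {n} (p q : IntFun n) → p ⊟ (p ⊟ q) ≡ q
p⊟[p⊟q]≡q {zero}  = leaf
  where leaf : ∀ (p q : ℤ) → p ℤ.- (p ℤ.- q) ≡ q
        leaf = solve-∀
p⊟[p⊟q]≡q {suc n} (p , p′) (q , q′) = cong₂ _,_ (p⊟[p⊟q]≡q p q) (p⊟[p⊟q]≡q p′ q′)

pos-2^suc : ∀ e → + (2 ^ suc e) ≡ + 2 ℤ.* + (2 ^ e)
pos-2^suc e = ℤP.pos-* 2 (2 ^ e)

2⊙2^e⊙p≡2^[1+e]⊙p : ∀ {n} e (p : IntFun n) → + 2 ⊙ + (2 ^ e) ⊙ p ≡ + (2 ^ suc e) ⊙ p
2⊙2^e⊙p≡2^[1+e]⊙p e p = trans (⊙-assoc (+ 2) (+ (2 ^ e)) p) (cong (_⊙ p) (sym (pos-2^suc e)))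

_!_ : ∀ {n} → IntFun n → Vertex n → ℤ
_!_ {zero}  a       []          = a
_!_ {suc n} (l , r) (false ∷ v) = l ! v
_!_ {suc n} (l , r) (true  ∷ v) = r ! v

fromFun : ∀ {n} → (Vertex n → ℤ) → IntFun n
fromFun {zero}  h = h []
fromFun {suc n} h = fromFun (h ∘ (false ∷_)) , fromFun (h ∘ (true ∷_))

!-fromFun : ∀ {n} (h : Vertex n → ℤ) v → fromFun h ! v ≡ h v
!-fromFun h []          = refl
!-fromFun h (false ∷ v) = !-fromFun (h ∘ (false ∷_)) v
!-fromFun h (true  ∷ v) = !-fromFun (h ∘ (true ∷_)) v

!-ext : ∀ {n} {p q : IntFun n} → (∀ v → p ! v ≡ q ! v) → p ≡ q
!-ext {zero}  eq = eq []
!-ext {suc n} eq = cong₂ _,_ (!-ext (eq ∘ (false ∷_))) (!-ext (eq ∘ (true ∷_)))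

!-⊞ : ∀ {n} (p q : IntFun n) v → (p ⊞ q) ! v ≡ p ! v ℤ.+ q ! v
!-⊞ p       q       []          = refl
!-⊞ (p , _) (q , _) (false ∷ v) = !-⊞ p q v
!-⊞ (_ , p) (_ , q) (true  ∷ v) = !-⊞ p q v

!-⊙ : ∀ {n} c (p : IntFun n) v → (c ⊙ p) ! v ≡ c ℤ.* p ! v
!-⊙ c p       []          = refl
!-⊙ c (p , _) (false ∷ v) = !-⊙ c p v
!-⊙ c (_ , p) (true  ∷ v) = !-⊙ c p v

-- The leaf of hadamard t at the path S (true = member) is Σ_v (−1)^|S ∩ v| · t ! v.
hadamard : ∀ {n} → IntFun n → IntFun n
hadamard {zero}  a       = a
hadamard {suc n} (l , r) = hadamard l ⊞ hadamard r , hadamard l ⊟ hadamard r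

hadamard-⊞ : ∀ {n} (p q : IntFun n) → hadamard (p ⊞ q) ≡ hadamard p ⊞ hadamard q
hadamard-⊞ {zero}  p q = refl
hadamard-⊞ {suc n} (p , p′) (q , q′)
  rewrite hadamard-⊞ p q | hadamard-⊞ p′ q′ =
  cong₂ _,_ (⊞-interchange (hadamard p) (hadamard q) (hadamard p′) (hadamard q′))
            (⊟-⊞-interchange (hadamard p) (hadamard q) (hadamard p′) (hadamard q′))

hadamard-⊟ : ∀ {n} (p q : IntFun n) → hadamard (p ⊟ q) ≡ hadamard p ⊟ hadamard q
hadamard-⊟ {zero}  p q = refl
hadamard-⊟ {suc n} (p , p′) (q , q′)
  rewrite hadamard-⊟ p q | hadamard-⊟ p′ q′ =
  cong₂ _,_ (sym (⊟-⊞-interchange (hadamard p) (hadamard p′) (hadamard q) (hadamard q′)))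
            (⊟-interchange (hadamard p) (hadamard q) (hadamard p′) (hadamard q′))

hadamard-⊙ : ∀ {n} c (p : IntFun n) → hadamard (c ⊙ p) ≡ c ⊙ hadamard p
hadamard-⊙ {zero}  c p = refl
hadamard-⊙ {suc n} c (p , q) rewrite hadamard-⊙ c p | hadamard-⊙ c q =
  cong₂ _,_ (sym (⊙-distrib-⊞ c (hadamard p) (hadamard q)))
            (sym (⊙-distrib-⊟ c (hadamard p) (hadamard q)))

hadamard-involutive : ∀ {n} (p : IntFun n) → hadamard (hadamard p) ≡ + (2 ^ n) ⊙ p
hadamard-involutive {zero}  p = sym (ℤP.*-identityˡ p)
hadamard-involutive {suc n} (p , q)
  rewrite hadamard-⊞ (hadamard p) (hadamard q) | hadamard-⊟ (hadamard p) (hadamard q)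
        | hadamard-involutive p | hadamard-involutive q =
  cong₂ _,_ (trans ([p⊞q]⊞[p⊟q]≡2⊙p (+ (2 ^ n) ⊙ p) (+ (2 ^ n) ⊙ q)) (2⊙2^e⊙p≡2^[1+e]⊙p n p))
            (trans ([p⊞q]⊟[p⊟q]≡2⊙q (+ (2 ^ n) ⊙ p) (+ (2 ^ n) ⊙ q)) (2⊙2^e⊙p≡2^[1+e]⊙p n q))

hadamard-injective : ∀ {n} (p q : IntFun n) → hadamard p ≡ hadamard q → p ≡ q
hadamard-injective {n} p q eq =
  ⊙-cancelˡ (+ (2 ^ n)) {{ℕP.m^n≢0 2 n}} p q
    (trans (sym (hadamard-involutive p)) (trans (cong hadamard eq) (hadamard-involutive q)))

hadamard-𝟙 : ∀ {n} → hadamard 𝟙 ≡ + (2 ^ n) ⊙ δ {n}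
hadamard-𝟙 {zero}  = refl
hadamard-𝟙 {suc n} rewrite hadamard-𝟙 {n} =
  cong₂ _,_ (trans (⊞-self (+ (2 ^ n) ⊙ δ)) (2⊙2^e⊙p≡2^[1+e]⊙p n δ))
            (trans (⊟-self (+ (2 ^ n) ⊙ δ)) (sym (⊙-zeroʳ _)))

‖_‖² : ∀ {n} → IntFun n → ℤ
‖_‖² {zero}  a       = a ℤ.* a
‖_‖² {suc n} (l , r) = ‖ l ‖² ℤ.+ ‖ r ‖²

‖⊞‖²+‖⊟‖² : ∀ {n} (p q : IntFun n) →
            ‖ p ⊞ q ‖² ℤ.+ ‖ p ⊟ q ‖² ≡ + 2 ℤ.* (‖ p ‖² ℤ.+ ‖ q ‖²)
‖⊞‖²+‖⊟‖² {zero}  = leaf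
  where leaf : ∀ (p q : ℤ) →
               (p ℤ.+ q) ℤ.* (p ℤ.+ q) ℤ.+ (p ℤ.- q) ℤ.* (p ℤ.- q) ≡ + 2 ℤ.* (p ℤ.* p ℤ.+ q ℤ.* q)
        leaf = solve-∀
‖⊞‖²+‖⊟‖² {suc n} (p , p′) (q , q′) = begin
  (‖ p ⊞ q ‖² ℤ.+ ‖ p′ ⊞ q′ ‖²) ℤ.+ (‖ p ⊟ q ‖² ℤ.+ ‖ p′ ⊟ q′ ‖²)
    ≡⟨ interchange ‖ p ⊞ q ‖² _ _ _ ⟩
  (‖ p ⊞ q ‖² ℤ.+ ‖ p ⊟ q ‖²) ℤ.+ (‖ p′ ⊞ q′ ‖² ℤ.+ ‖ p′ ⊟ q′ ‖²)
    ≡⟨ cong₂ ℤ._+_ (‖⊞‖²+‖⊟‖² p q) (‖⊞‖²+‖⊟‖² p′ q′) ⟩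
  + 2 ℤ.* (‖ p ‖² ℤ.+ ‖ q ‖²) ℤ.+ + 2 ℤ.* (‖ p′ ‖² ℤ.+ ‖ q′ ‖²)
    ≡⟨ sym (ℤP.*-distribˡ-+ (+ 2) (‖ p ‖² ℤ.+ ‖ q ‖²) (‖ p′ ‖² ℤ.+ ‖ q′ ‖²)) ⟩
  + 2 ℤ.* ((‖ p ‖² ℤ.+ ‖ q ‖²) ℤ.+ (‖ p′ ‖² ℤ.+ ‖ q′ ‖²))
    ≡⟨ cong (+ 2 ℤ.*_) (interchange ‖ p ‖² _ _ _) ⟩
  + 2 ℤ.* ((‖ p ‖² ℤ.+ ‖ p′ ‖²) ℤ.+ (‖ q ‖² ℤ.+ ‖ q′ ‖²)) ∎
  where open ≡-Reasoning

‖hadamard‖² : ∀ {n} (p : IntFun n) → ‖ hadamard p ‖² ≡ + (2 ^ n) ℤ.* ‖ p ‖²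
‖hadamard‖² {zero}  p = sym (ℤP.*-identityˡ (p ℤ.* p))
‖hadamard‖² {suc n} (p , q) = begin
  ‖ hadamard p ⊞ hadamard q ‖² ℤ.+ ‖ hadamard p ⊟ hadamard q ‖²
    ≡⟨ ‖⊞‖²+‖⊟‖² (hadamard p) (hadamard q) ⟩
  + 2 ℤ.* (‖ hadamard p ‖² ℤ.+ ‖ hadamard q ‖²)
    ≡⟨ cong (+ 2 ℤ.*_) (cong₂ ℤ._+_ (‖hadamard‖² p) (‖hadamard‖² q)) ⟩
  + 2 ℤ.* (+ (2 ^ n) ℤ.* ‖ p ‖² ℤ.+ + (2 ^ n) ℤ.* ‖ q ‖²)
    ≡⟨ cong (+ 2 ℤ.*_) (sym (ℤP.*-distribˡ-+ (+ (2 ^ n)) ‖ p ‖² ‖ q ‖²)) ⟩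
  + 2 ℤ.* (+ (2 ^ n) ℤ.* (‖ p ‖² ℤ.+ ‖ q ‖²))
    ≡⟨ sym (ℤP.*-assoc (+ 2) (+ (2 ^ n)) (‖ p ‖² ℤ.+ ‖ q ‖²)) ⟩
  + 2 ℤ.* + (2 ^ n) ℤ.* (‖ p ‖² ℤ.+ ‖ q ‖²)
    ≡⟨ cong (ℤ._* (‖ p ‖² ℤ.+ ‖ q ‖²)) (sym (pos-2^suc n)) ⟩
  + (2 ^ suc n) ℤ.* (‖ p ‖² ℤ.+ ‖ q ‖²) ∎
  where open ≡-Reasoning

‖⊙‖² : ∀ {n} c (p : IntFun n) → ‖ c ⊙ p ‖² ≡ c ℤ.* (c ℤ.* ‖ p ‖²)
‖⊙‖² {zero}  = leaf
  where leaf : ∀ (c p : ℤ) → (c ℤ.* p) ℤ.* (c ℤ.* p) ≡ c ℤ.* (c ℤ.* (p ℤ.* p))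
        leaf = solve-∀
‖⊙‖² {suc n} c (p , q) = begin
  ‖ c ⊙ p ‖² ℤ.+ ‖ c ⊙ q ‖²
    ≡⟨ cong₂ ℤ._+_ (‖⊙‖² c p) (‖⊙‖² c q) ⟩
  c ℤ.* (c ℤ.* ‖ p ‖²) ℤ.+ c ℤ.* (c ℤ.* ‖ q ‖²)
    ≡⟨ sym (ℤP.*-distribˡ-+ c (c ℤ.* ‖ p ‖²) (c ℤ.* ‖ q ‖²)) ⟩
  c ℤ.* (c ℤ.* ‖ p ‖² ℤ.+ c ℤ.* ‖ q ‖²)
    ≡⟨ cong (c ℤ.*_) (sym (ℤP.*-distribˡ-+ c ‖ p ‖² ‖ q ‖²)) ⟩
  c ℤ.* (c ℤ.* (‖ p ‖² ℤ.+ ‖ q ‖²)) ∎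
  where open ≡-Reasoning

neighbourSum : ∀ {n} → IntFun n → IntFun n
neighbourSum {zero}  a       = + 0
neighbourSum {suc n} (l , r) = neighbourSum l ⊞ r , neighbourSum r ⊞ l

neighbourSum-⊞ : ∀ {n} (p q : IntFun n) → neighbourSum (p ⊞ q) ≡ neighbourSum p ⊞ neighbourSum q
neighbourSum-⊞ {zero}  p q = refl
neighbourSum-⊞ {suc n} (p , p′) (q , q′) rewrite neighbourSum-⊞ p q | neighbourSum-⊞ p′ q′ =
  cong₂ _,_ (⊞-interchange (neighbourSum p) (neighbourSum q) p′ q′)
            (⊞-interchange (neighbourSum p′) (neighbourSum q′) p q)

neighbourSum-⊟ : ∀ {n} (p q : IntFun n) → neighbourSum (p ⊟ q) ≡ neighbourSum p ⊟ neighbourSum q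
neighbourSum-⊟ {zero}  p q = refl
neighbourSum-⊟ {suc n} (p , p′) (q , q′) rewrite neighbourSum-⊟ p q | neighbourSum-⊟ p′ q′ =
  cong₂ _,_ (sym (⊟-⊞-interchange (neighbourSum p) p′ (neighbourSum q) q′))
            (sym (⊟-⊞-interchange (neighbourSum p′) p (neighbourSum q′) q))

sumℤ : List ℤ → ℤ
sumℤ = List.foldr ℤ._+_ (+ 0)

!-neighbourSum : ∀ {n} (p : IntFun n) v → neighbourSum p ! v ≡ sumℤ (tabulate (λ i → p ! flip i v))
!-neighbourSum p []                = refl
!-neighbourSum (l , r) (false ∷ v) = begin
  (neighbourSum l ⊞ r) ! v                        ≡⟨ !-⊞ (neighbourSum l) r v ⟩
  neighbourSum l ! v ℤ.+ r ! v                    ≡⟨ cong (ℤ._+ r ! v) (!-neighbourSum l v) ⟩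
  sumℤ (tabulate (λ i → l ! flip i v)) ℤ.+ r ! v  ≡⟨ ℤP.+-comm _ (r ! v) ⟩
  r ! v ℤ.+ sumℤ (tabulate (λ i → l ! flip i v))  ∎
  where open ≡-Reasoning
!-neighbourSum (l , r) (true ∷ v) = begin
  (neighbourSum r ⊞ l) ! v                        ≡⟨ !-⊞ (neighbourSum r) l v ⟩
  neighbourSum r ! v ℤ.+ l ! v                    ≡⟨ cong (ℤ._+ l ! v) (!-neighbourSum r v) ⟩
  sumℤ (tabulate (λ i → r ! flip i v)) ℤ.+ l ! v  ≡⟨ ℤP.+-comm _ (l ! v) ⟩
  l ! v ℤ.+ sumℤ (tabulate (λ i → r ! flip i v))  ∎
  where open ≡-Reasoning

eigen-⊞ : ∀ {n} μ (x y l r : IntFun n) → x ⊞ r ≡ μ ⊙ l → y ⊞ l ≡ μ ⊙ r →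
          x ⊞ y ≡ (μ ℤ.- + 1) ⊙ (l ⊞ r)
eigen-⊞ {zero} μ x y l r eqˡ eqʳ = begin
  x ℤ.+ y                                ≡⟨ regroup x y l r ⟩
  (x ℤ.+ r) ℤ.+ (y ℤ.+ l) ℤ.- (l ℤ.+ r)  ≡⟨ cong₂ (λ a b → a ℤ.+ b ℤ.- (l ℤ.+ r)) eqˡ eqʳ ⟩
  μ ℤ.* l ℤ.+ μ ℤ.* r ℤ.- (l ℤ.+ r)      ≡⟨ factor μ l r ⟩
  (μ ℤ.- + 1) ℤ.* (l ℤ.+ r) ∎
  where
  open ≡-Reasoning
  regroup : ∀ (x y l r : ℤ) → x ℤ.+ y ≡ (x ℤ.+ r) ℤ.+ (y ℤ.+ l) ℤ.- (l ℤ.+ r)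
  regroup = solve-∀
  factor : ∀ (μ l r : ℤ) → μ ℤ.* l ℤ.+ μ ℤ.* r ℤ.- (l ℤ.+ r) ≡ (μ ℤ.- + 1) ℤ.* (l ℤ.+ r)
  factor = solve-∀
eigen-⊞ {suc n} μ (x , x′) (y , y′) (l , l′) (r , r′) eqˡ eqʳ =
  cong₂ _,_ (eigen-⊞ μ x y l r (proj₁ (,-injective eqˡ)) (proj₁ (,-injective eqʳ)))
            (eigen-⊞ μ x′ y′ l′ r′ (proj₂ (,-injective eqˡ)) (proj₂ (,-injective eqʳ)))

eigen-⊟ : ∀ {n} μ (x y l r : IntFun n) → x ⊞ r ≡ μ ⊙ l → y ⊞ l ≡ μ ⊙ r →
          x ⊟ y ≡ (μ ℤ.+ + 1) ⊙ (l ⊟ r)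
eigen-⊟ {zero} μ x y l r eqˡ eqʳ = begin
  x ℤ.- y                                ≡⟨ regroup x y l r ⟩
  (x ℤ.+ r) ℤ.- (y ℤ.+ l) ℤ.+ (l ℤ.- r)  ≡⟨ cong₂ (λ a b → a ℤ.- b ℤ.+ (l ℤ.- r)) eqˡ eqʳ ⟩
  μ ℤ.* l ℤ.- μ ℤ.* r ℤ.+ (l ℤ.- r)      ≡⟨ factor μ l r ⟩
  (μ ℤ.+ + 1) ℤ.* (l ℤ.- r) ∎
  where
  open ≡-Reasoning
  regroup : ∀ (x y l r : ℤ) → x ℤ.- y ≡ (x ℤ.+ r) ℤ.- (y ℤ.+ l) ℤ.+ (l ℤ.- r)
  regroup = solve-∀
  factor : ∀ (μ l r : ℤ) → μ ℤ.* l ℤ.- μ ℤ.* r ℤ.+ (l ℤ.- r) ≡ (μ ℤ.+ + 1) ℤ.* (l ℤ.- r)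
  factor = solve-∀
eigen-⊟ {suc n} μ (x , x′) (y , y′) (l , l′) (r , r′) eqˡ eqʳ =
  cong₂ _,_ (eigen-⊟ μ x y l r (proj₁ (,-injective eqˡ)) (proj₁ (,-injective eqʳ)))
            (eigen-⊟ μ x′ y′ l′ r′ (proj₂ (,-injective eqˡ)) (proj₂ (,-injective eqʳ)))

-- EigenSupported n μ u: u vanishes at every S with n − 2|S| ≠ μ.
EigenSupported : (n : ℕ) → ℤ → IntFun n → Set
EigenSupported zero    μ a       = μ ≡ + 0 ⊎ a ≡ + 0
EigenSupported (suc n) μ (a , b) = EigenSupported n (μ ℤ.- + 1) a × EigenSupported n (μ ℤ.+ + 1) b

hadamard-eigenSupported : ∀ {n} μ (p : IntFun n) → neighbourSum p ≡ μ ⊙ p →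
                          EigenSupported n μ (hadamard p)
hadamard-eigenSupported {zero}  μ a eq = ℤP.i*j≡0⇒i≡0∨j≡0 μ (sym eq)
hadamard-eigenSupported {suc n} μ (l , r) eq =
  subst (EigenSupported n (μ ℤ.- + 1)) (hadamard-⊞ l r)
    (hadamard-eigenSupported (μ ℤ.- + 1) (l ⊞ r)
      (trans (neighbourSum-⊞ l r) (eigen-⊞ μ (neighbourSum l) (neighbourSum r) l r eqˡ eqʳ))) ,
  subst (EigenSupported n (μ ℤ.+ + 1)) (hadamard-⊟ l r)
    (hadamard-eigenSupported (μ ℤ.+ + 1) (l ⊟ r)
      (trans (neighbourSum-⊟ l r) (eigen-⊟ μ (neighbourSum l) (neighbourSum r) l r eqˡ eqʳ)))
  where
  eqˡ : neighbourSum l ⊞ r ≡ μ ⊙ l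
  eqˡ = proj₁ (,-injective eq)
  eqʳ : neighbourSum r ⊞ l ≡ μ ⊙ r
  eqʳ = proj₂ (,-injective eq)

eigenSupported-beyond : ∀ n j (u : IntFun n) → EigenSupported n (+ n ℤ.+ + suc j) u → u ≡ 𝟘
eigenSupported-beyond zero    j a (inj₂ a≡0) = a≡0
eigenSupported-beyond (suc n) j (a , b) (sa , sb) =
  cong₂ _,_ (eigenSupported-beyond n j a (subst (λ μ → EigenSupported n μ a) (shiftˡ (+ n) (+ suc j)) sa))
            (eigenSupported-beyond n (suc (suc j)) b (subst (λ μ → EigenSupported n μ b) (shiftʳ (+ n) (+ j)) sb))
  where
  shiftˡ : ∀ x y → (+ 1 ℤ.+ x) ℤ.+ y ℤ.- + 1 ≡ x ℤ.+ y
  shiftˡ = solve-∀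
  shiftʳ : ∀ x y → (+ 1 ℤ.+ x) ℤ.+ (+ 1 ℤ.+ y) ℤ.+ + 1 ≡ x ℤ.+ (+ 3 ℤ.+ y)
  shiftʳ = solve-∀

-- Homogeneous n k u: u vanishes at every S with |S| ≠ k.
Homogeneous : (n k : ℕ) → IntFun n → Set
Homogeneous zero    zero    a       = ⊤
Homogeneous zero    (suc k) a       = a ≡ + 0
Homogeneous (suc n) zero    (a , b) = Homogeneous n zero a × b ≡ 𝟘
Homogeneous (suc n) (suc k) (a , b) = Homogeneous n (suc k) a × Homogeneous n k b

eigenvalue : ℕ → ℕ → ℤ
eigenvalue n k = + n ℤ.- + 2 ℤ.* + k

eigenSupported⇒homogeneous : ∀ n k (u : IntFun n) → EigenSupported n (eigenvalue n k) u → Homogeneous n k u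
eigenSupported⇒homogeneous zero    zero    a _          = tt
eigenSupported⇒homogeneous zero    (suc k) a (inj₂ a≡0) = a≡0
eigenSupported⇒homogeneous (suc n) zero    (a , b) (sa , sb) =
  eigenSupported⇒homogeneous n zero a (subst (λ μ → EigenSupported n μ a) (shiftˡ (+ n) (+ 0)) sa) ,
  eigenSupported-beyond n 1 b (subst (λ μ → EigenSupported n μ b) (shift₀ (+ n)) sb)
  where
  shiftˡ : ∀ x y → (+ 1 ℤ.+ x) ℤ.- + 2 ℤ.* y ℤ.- + 1 ≡ x ℤ.- + 2 ℤ.* y
  shiftˡ = solve-∀
  shift₀ : ∀ x → (+ 1 ℤ.+ x) ℤ.- + 2 ℤ.* + 0 ℤ.+ + 1 ≡ x ℤ.+ + 2
  shift₀ = solve-∀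
eigenSupported⇒homogeneous (suc n) (suc k) (a , b) (sa , sb) =
  eigenSupported⇒homogeneous n (suc k) a (subst (λ μ → EigenSupported n μ a) (shiftˡ (+ n) (+ suc k)) sa) ,
  eigenSupported⇒homogeneous n k b (subst (λ μ → EigenSupported n μ b) (shiftʳ (+ n) (+ k)) sb)
  where
  shiftˡ : ∀ x y → (+ 1 ℤ.+ x) ℤ.- + 2 ℤ.* y ℤ.- + 1 ≡ x ℤ.- + 2 ℤ.* y
  shiftˡ = solve-∀
  shiftʳ : ∀ x y → (+ 1 ℤ.+ x) ℤ.- + 2 ℤ.* (+ 1 ℤ.+ y) ℤ.+ + 1 ≡ x ℤ.- + 2 ℤ.* y
  shiftʳ = solve-∀

homogeneous-cancelˡ : ∀ n k c .{{_ : ℤ.NonZero c}} (u : IntFun n) → Homogeneous n k (c ⊙ u) → Homogeneous n k u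
homogeneous-cancelˡ zero    zero    c a       _        = tt
homogeneous-cancelˡ zero    (suc k) c a       h        = ⊙≡𝟘 c a h
homogeneous-cancelˡ (suc n) zero    c (a , b) (ha , hb) = homogeneous-cancelˡ n zero c a ha , ⊙≡𝟘 c b hb
homogeneous-cancelˡ (suc n) (suc k) c (a , b) (ha , hb) =
  homogeneous-cancelˡ n (suc k) c a ha , homogeneous-cancelˡ n k c b hb

-- DegreeBelow n d u: u vanishes at every S with |S| ≥ d.
DegreeBelow : (n d : ℕ) → IntFun n → Set
DegreeBelow zero    zero    a       = a ≡ + 0
DegreeBelow zero    (suc d) a       = ⊤
DegreeBelow (suc n) zero    (a , b) = DegreeBelow n zero a × DegreeBelow n zero b
DegreeBelow (suc n) (suc d) (a , b) = DegreeBelow n (suc d) a × DegreeBelow n d b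

degreeBelow0⇒≡𝟘 : ∀ n (u : IntFun n) → DegreeBelow n zero u → u ≡ 𝟘
degreeBelow0⇒≡𝟘 zero    a       a≡0       = a≡0
degreeBelow0⇒≡𝟘 (suc n) (a , b) (da , db) =
  cong₂ _,_ (degreeBelow0⇒≡𝟘 n a da) (degreeBelow0⇒≡𝟘 n b db)

degreeBelow-𝟘 : ∀ n d → DegreeBelow n d 𝟘
degreeBelow-𝟘 zero    zero    = refl
degreeBelow-𝟘 zero    (suc d) = tt
degreeBelow-𝟘 (suc n) zero    = degreeBelow-𝟘 n zero , degreeBelow-𝟘 n zero
degreeBelow-𝟘 (suc n) (suc d) = degreeBelow-𝟘 n (suc d) , degreeBelow-𝟘 n d

degreeBelow-suc : ∀ n d (u : IntFun n) → DegreeBelow n d u → DegreeBelow n (suc d) u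
degreeBelow-suc zero    d       a       _         = tt
degreeBelow-suc (suc n) zero    (a , b) (da , db) =
  degreeBelow-suc n zero a da , subst (DegreeBelow n zero) (sym (degreeBelow0⇒≡𝟘 n b db)) (degreeBelow-𝟘 n zero)
degreeBelow-suc (suc n) (suc d) (a , b) (da , db) = degreeBelow-suc n (suc d) a da , degreeBelow-suc n d b db

degreeBelow-⊟ : ∀ n d (u v : IntFun n) → DegreeBelow n d u → DegreeBelow n d v → DegreeBelow n d (u ⊟ v)
degreeBelow-⊟ zero    zero    a b refl refl = refl
degreeBelow-⊟ zero    (suc d) a b _ _ = tt
degreeBelow-⊟ (suc n) zero    (a , b) (a′ , b′) (da , db) (da′ , db′) =
  degreeBelow-⊟ n zero a a′ da da′ , degreeBelow-⊟ n zero b b′ db db′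
degreeBelow-⊟ (suc n) (suc d) (a , b) (a′ , b′) (da , db) (da′ , db′) =
  degreeBelow-⊟ n (suc d) a a′ da da′ , degreeBelow-⊟ n d b b′ db db′

degreeBelow-cancelˡ : ∀ n d c .{{_ : ℤ.NonZero c}} (u : IntFun n) → DegreeBelow n d (c ⊙ u) → DegreeBelow n d u
degreeBelow-cancelˡ zero    zero    c a       h         = ⊙≡𝟘 c a h
degreeBelow-cancelˡ zero    (suc d) c a       _         = tt
degreeBelow-cancelˡ (suc n) zero    c (a , b) (da , db) =
  degreeBelow-cancelˡ n zero c a da , degreeBelow-cancelˡ n zero c b db
degreeBelow-cancelˡ (suc n) (suc d) c (a , b) (da , db) =
  degreeBelow-cancelˡ n (suc d) c a da , degreeBelow-cancelˡ n d c b db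

homogeneous⇒degreeBelow : ∀ n k (u : IntFun n) → Homogeneous n k u → DegreeBelow n (suc k) u
homogeneous⇒degreeBelow zero    k       a       _         = tt
homogeneous⇒degreeBelow (suc n) zero    (a , b) (ha , b≡𝟘) =
  homogeneous⇒degreeBelow n zero a ha , subst (DegreeBelow n zero) (sym b≡𝟘) (degreeBelow-𝟘 n zero)
homogeneous⇒degreeBelow (suc n) (suc k) (a , b) (ha , hb) =
  homogeneous⇒degreeBelow n (suc k) a ha , homogeneous⇒degreeBelow n k b hb

degreeBelow-⊙δ : ∀ n d c → DegreeBelow n (suc d) (c ⊙ δ)
degreeBelow-⊙δ zero    d c = tt
degreeBelow-⊙δ (suc n) d c = degreeBelow-⊙δ n d c , subst (DegreeBelow n d) (sym (⊙-zeroʳ c)) (degreeBelow-𝟘 n d)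

-- Splitting on the first coordinate, the difference half l̂ − r̂ has degree one lower and
-- so gains a factor 2, while 2·r̂ = (l̂ + r̂) − (l̂ − r̂) has the same degree bound as t̂.
granularity : ∀ n d e (t : IntFun n) → e + d ≤ suc n → DegreeBelow n d (hadamard t) →
              ∃[ y ] hadamard t ≡ + (2 ^ e) ⊙ y
granularity n       d       zero    t _ _ = hadamard t , sym (⊙-identityˡ (hadamard t))
granularity n       zero    (suc e) t _ deg =
  𝟘 , trans (degreeBelow0⇒≡𝟘 n (hadamard t) deg) (sym (⊙-zeroʳ (+ (2 ^ suc e))))
granularity zero    (suc d) (suc e) t (s≤s le) _ with () ← subst (_≤ 0) (ℕP.+-suc e d) le
granularity (suc n) (suc d) (suc e) (l , r) (s≤s le) (deg⊞ , deg⊟) =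
  (y⊟ ⊞ yʳ , y⊟) , cong₂ _,_ hl⊞hr hl⊟hr
  where
  hl⊟hr-divisible : ∃[ y ] hadamard (l ⊟ r) ≡ + (2 ^ suc e) ⊙ y
  hl⊟hr-divisible = granularity n d (suc e) (l ⊟ r) (subst (_≤ suc n) (ℕP.+-suc e d) le)
                      (subst (DegreeBelow n d) (sym (hadamard-⊟ l r)) deg⊟)
  y⊟ : IntFun n
  y⊟ = proj₁ hl⊟hr-divisible
  hl⊟hr : hadamard l ⊟ hadamard r ≡ + (2 ^ suc e) ⊙ y⊟
  hl⊟hr = trans (sym (hadamard-⊟ l r)) (proj₂ hl⊟hr-divisible)
  deg-hr : DegreeBelow n (suc d) (hadamard r)
  deg-hr = degreeBelow-cancelˡ n (suc d) (+ 2) (hadamard r)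
             (subst (DegreeBelow n (suc d)) ([p⊞q]⊟[p⊟q]≡2⊙q (hadamard l) (hadamard r))
               (degreeBelow-⊟ n (suc d) _ _ deg⊞ (degreeBelow-suc n d _ deg⊟)))
  hr-divisible : ∃[ y ] hadamard r ≡ + (2 ^ e) ⊙ y
  hr-divisible = granularity n (suc d) e r le deg-hr
  yʳ : IntFun n
  yʳ = proj₁ hr-divisible
  hl⊞hr : hadamard l ⊞ hadamard r ≡ + (2 ^ suc e) ⊙ (y⊟ ⊞ yʳ)
  hl⊞hr = begin
    hadamard l ⊞ hadamard r
      ≡⟨ p⊞q≡[p⊟q]⊞2⊙q (hadamard l) (hadamard r) ⟩
    (hadamard l ⊟ hadamard r) ⊞ + 2 ⊙ hadamard r
      ≡⟨ cong₂ (λ a b → a ⊞ + 2 ⊙ b) hl⊟hr (proj₂ hr-divisible) ⟩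
    + (2 ^ suc e) ⊙ y⊟ ⊞ + 2 ⊙ + (2 ^ e) ⊙ yʳ
      ≡⟨ cong (+ (2 ^ suc e) ⊙ y⊟ ⊞_) (2⊙2^e⊙p≡2^[1+e]⊙p e yʳ) ⟩
    + (2 ^ suc e) ⊙ y⊟ ⊞ + (2 ^ suc e) ⊙ yʳ
      ≡⟨ sym (⊙-distrib-⊞ (+ (2 ^ suc e)) y⊟ yʳ) ⟩
    + (2 ^ suc e) ⊙ (y⊟ ⊞ yʳ) ∎
    where open ≡-Reasoning

sign bit : Bool → ℤ
sign false = + 1
sign true  = -[1+ 0 ]
bit false = + 0
bit true  = + 1

signs indicator : ∀ {n} → BoolFun n → IntFun n
signs f     = fromFun (sign ∘ f)
indicator f = fromFun (bit ∘ f)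

signs≡𝟙⊟2⊙indicator : ∀ {n} (f : BoolFun n) → signs f ≡ 𝟙 ⊟ + 2 ⊙ indicator f
signs≡𝟙⊟2⊙indicator {zero} f with f []
... | false = refl
... | true  = refl
signs≡𝟙⊟2⊙indicator {suc n} f =
  cong₂ _,_ (signs≡𝟙⊟2⊙indicator (f ∘ (false ∷_))) (signs≡𝟙⊟2⊙indicator (f ∘ (true ∷_)))

‖signs‖² : ∀ {n} (f : BoolFun n) → ‖ signs f ‖² ≡ + (2 ^ n)
‖signs‖² {zero} f with f []
... | false = refl
... | true  = refl
‖signs‖² {suc n} f = begin
  ‖ signs (f ∘ (false ∷_)) ‖² ℤ.+ ‖ signs (f ∘ (true ∷_)) ‖²
    ≡⟨ cong₂ ℤ._+_ (‖signs‖² (f ∘ (false ∷_))) (‖signs‖² (f ∘ (true ∷_))) ⟩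
  + (2 ^ n) ℤ.+ + (2 ^ n)                                   ≡⟨ ⊞-self {zero} (+ (2 ^ n)) ⟩
  + 2 ℤ.* + (2 ^ n)                                         ≡⟨ sym (pos-2^suc n) ⟩
  + (2 ^ suc n) ∎
  where open ≡-Reasoning

signs-injective : ∀ {n} (f g : BoolFun n) → signs f ≡ signs g → ∀ v → f v ≡ g v
signs-injective f g eq v = sign-injective (begin
  sign (f v)   ≡⟨ sym (!-fromFun (sign ∘ f) v) ⟩
  signs f ! v  ≡⟨ cong (_! v) eq ⟩
  signs g ! v  ≡⟨ !-fromFun (sign ∘ g) v ⟩
  sign (g v) ∎)
  where
  open ≡-Reasoning
  sign-injective : ∀ {b c} → sign b ≡ sign c → b ≡ c
  sign-injective {false} {false} _ = refl
  sign-injective {true}  {true}  _ = refl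

sum-map-sign : ∀ {X : Set} b (c : X → Bool) (xs : List X) →
               sumℤ (map (sign ∘ c) xs) ≡
               (+ length xs ℤ.- + 2 ℤ.* + length (filter (λ x → ¬? (b ≟ c x)) xs)) ℤ.* sign b
sum-map-sign b c [] = sym (ℤP.*-zeroˡ (sign b))
sum-map-sign b c (x ∷ xs) with b ≟ c x
... | yes refl = trans (cong (ℤ._+_ (sign b)) (sum-map-sign b c xs)) (agree (sign b) (+ length xs) m)
  where
  m : ℤ
  m = + length (filter (λ x → ¬? (b ≟ c x)) xs)
  agree : ∀ s l m → s ℤ.+ (l ℤ.- + 2 ℤ.* m) ℤ.* s ≡ ((+ 1 ℤ.+ l) ℤ.- + 2 ℤ.* m) ℤ.* s
  agree = solve-∀
... | no b≢cx = trans (cong₂ ℤ._+_ (opposite b≢cx) (sum-map-sign b c xs)) (disagree (sign b) (+ length xs) m)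
  where
  m : ℤ
  m = + length (filter (λ x → ¬? (b ≟ c x)) xs)
  opposite : ∀ {b b′} → b ≢ b′ → sign b′ ≡ ℤ.- sign b
  opposite {false} {false} ne = ⊥-elim (ne refl)
  opposite {false} {true}  _  = refl
  opposite {true}  {false} _  = refl
  opposite {true}  {true}  ne = ⊥-elim (ne refl)
  disagree : ∀ s l m → ℤ.- s ℤ.+ (l ℤ.- + 2 ℤ.* m) ℤ.* s ≡ ((+ 1 ℤ.+ l) ℤ.- + 2 ℤ.* (+ 1 ℤ.+ m)) ℤ.* s
  disagree = solve-∀

kFunction⇒eigenvector : ∀ {n k} (f : BoolFun n) → IsKFunction n k f →
                        neighbourSum (signs f) ≡ eigenvalue n k ⊙ signs f
kFunction⇒eigenvector {n} {k} f kf = !-ext λ v → begin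
  neighbourSum (signs f) ! v
    ≡⟨ !-neighbourSum (signs f) v ⟩
  sumℤ (tabulate (λ i → signs f ! flip i v))
    ≡⟨ cong sumℤ (ListP.tabulate-cong (λ i → !-fromFun (sign ∘ f) (flip i v))) ⟩
  sumℤ (tabulate (λ i → sign (f (flip i v))))
    ≡⟨ cong sumℤ (sym (ListP.map-tabulate (λ i → i) (λ i → sign (f (flip i v))))) ⟩
  sumℤ (map (λ i → sign (f (flip i v))) (allFin n))
    ≡⟨ sum-map-sign (f v) (λ i → f (flip i v)) (allFin n) ⟩
  (+ length (allFin n) ℤ.- + 2 ℤ.* + disagreeCount f v) ℤ.* sign (f v)
    ≡⟨ cong₂ (λ a b → (+ a ℤ.- + 2 ℤ.* + b) ℤ.* sign (f v)) (ListP.length-tabulate (λ i → i)) (kf v) ⟩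
  eigenvalue n k ℤ.* sign (f v)
    ≡⟨ cong (eigenvalue n k ℤ.*_) (sym (!-fromFun (sign ∘ f) v)) ⟩
  eigenvalue n k ℤ.* (signs f ! v)
    ≡⟨ sym (!-⊙ (eigenvalue n k) (signs f) v) ⟩
  (eigenvalue n k ⊙ signs f) ! v ∎
  where open ≡-Reasoning

hadamard-signs-homogeneous : ∀ {n k} (f : BoolFun n) → IsKFunction n k f → Homogeneous n k (hadamard (signs f))
hadamard-signs-homogeneous {n} {k} f kf =
  eigenSupported⇒homogeneous n k _ (hadamard-eigenSupported _ (signs f) (kFunction⇒eigenvector f kf))

+2^[1+k+e]≡+2^[1+e]*+2^k : ∀ k e → + (2 ^ (suc k + e)) ≡ + (2 ^ suc e) ℤ.* + (2 ^ k)
+2^[1+k+e]≡+2^[1+e]*+2^k k e = begin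
  + (2 ^ (suc k + e))        ≡⟨ cong (λ m → + (2 ^ suc m)) (ℕP.+-comm k e) ⟩
  + (2 ^ (suc e + k))        ≡⟨ cong +_ (ℕP.^-distribˡ-+-* 2 (suc e) k) ⟩
  + (2 ^ suc e ℕ.* 2 ^ k)    ≡⟨ ℤP.pos-* (2 ^ suc e) (2 ^ k) ⟩
  + (2 ^ suc e) ℤ.* + (2 ^ k) ∎
  where open ≡-Reasoning

hadamard-signs-divisible : ∀ k e (f : BoolFun (suc k + e)) →
                           DegreeBelow (suc k + e) (suc (suc k)) (hadamard (signs f)) →
                           ∃[ y ] hadamard (signs f) ≡ + (2 ^ suc e) ⊙ y
hadamard-signs-divisible k e f deg = + (2 ^ k) ⊙ δ ⊟ y₀ , (begin
  hadamard (signs f)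
    ≡⟨ hadamard-signs ⟩
  hadamard 𝟙 ⊟ + 2 ⊙ hadamard (indicator f)
    ≡⟨ cong₂ (λ a b → a ⊟ + 2 ⊙ b) hadamard-𝟙 (proj₂ indicator-divisible) ⟩
  + (2 ^ n) ⊙ δ ⊟ + 2 ⊙ + (2 ^ e) ⊙ y₀
    ≡⟨ cong₂ (λ a b → a ⊙ δ ⊟ b) (+2^[1+k+e]≡+2^[1+e]*+2^k k e) (2⊙2^e⊙p≡2^[1+e]⊙p e y₀) ⟩
  (c ℤ.* + (2 ^ k)) ⊙ δ ⊟ c ⊙ y₀
    ≡⟨ cong (_⊟ c ⊙ y₀) (sym (⊙-assoc c (+ (2 ^ k)) δ)) ⟩
  c ⊙ + (2 ^ k) ⊙ δ ⊟ c ⊙ y₀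
    ≡⟨ sym (⊙-distrib-⊟ c (+ (2 ^ k) ⊙ δ) y₀) ⟩
  c ⊙ (+ (2 ^ k) ⊙ δ ⊟ y₀) ∎)
  where
  open ≡-Reasoning
  n : ℕ
  n = suc k + e
  c : ℤ
  c = + (2 ^ suc e)
  hadamard-signs : hadamard (signs f) ≡ hadamard 𝟙 ⊟ + 2 ⊙ hadamard (indicator f)
  hadamard-signs = begin
    hadamard (signs f)                          ≡⟨ cong hadamard (signs≡𝟙⊟2⊙indicator f) ⟩
    hadamard (𝟙 ⊟ + 2 ⊙ indicator f)            ≡⟨ hadamard-⊟ 𝟙 (+ 2 ⊙ indicator f) ⟩
    hadamard 𝟙 ⊟ hadamard (+ 2 ⊙ indicator f)   ≡⟨ cong (hadamard 𝟙 ⊟_) (hadamard-⊙ (+ 2) (indicator f)) ⟩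
    hadamard 𝟙 ⊟ + 2 ⊙ hadamard (indicator f) ∎
  deg-indicator : DegreeBelow n (suc (suc k)) (hadamard (indicator f))
  deg-indicator = degreeBelow-cancelˡ n (suc (suc k)) (+ 2) (hadamard (indicator f))
    (subst (DegreeBelow n (suc (suc k)))
           (trans (cong (hadamard 𝟙 ⊟_) hadamard-signs) (p⊟[p⊟q]≡q (hadamard 𝟙) _))
           (degreeBelow-⊟ n (suc (suc k)) (hadamard 𝟙) (hadamard (signs f))
             (subst (DegreeBelow n (suc (suc k))) (sym hadamard-𝟙) (degreeBelow-⊙δ n (suc k) (+ (2 ^ n))))
             deg))
  indicator-divisible : ∃[ y ] hadamard (indicator f) ≡ + (2 ^ e) ⊙ y
  indicator-divisible =
    granularity n (suc (suc k)) e (indicator f) (ℕP.≤-reflexive (ℕP.+-comm e (suc (suc k)))) deg-indicator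
  y₀ : IntFun n
  y₀ = proj₁ indicator-divisible

4^k≡2^k*2^k : ∀ k → 4 ^ k ≡ 2 ^ k ℕ.* 2 ^ k
4^k≡2^k*2^k zero    = refl
4^k≡2^k*2^k (suc k) = trans (cong (4 ℕ.*_) (4^k≡2^k*2^k k)) (regroup (2 ^ k))
  where
  regroup : ∀ a → 4 ℕ.* (a ℕ.* a) ≡ (2 ℕ.* a) ℕ.* (2 ℕ.* a)
  regroup = ℕSolver.solve-∀

kFunction-scaledSpectrum : ∀ k e (f : BoolFun (suc k + e)) → IsKFunction (suc k + e) (suc k) f →
  ∃[ y ] Homogeneous (suc k + e) (suc k) y × hadamard (signs f) ≡ + (2 ^ suc e) ⊙ y × ‖ y ‖² ≡ + (4 ^ k)
kFunction-scaledSpectrum k e f kf =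
  y , homogeneous-cancelˡ n (suc k) c y (subst (Homogeneous n (suc k)) σ̂≡c⊙y σ̂-homogeneous) ,
  σ̂≡c⊙y , ‖y‖²≡
  where
  open ≡-Reasoning
  n : ℕ
  n = suc k + e
  c : ℤ
  c = + (2 ^ suc e)
  instance
    c≢0 : ℤ.NonZero c
    c≢0 = ℕP.m^n≢0 2 (suc e)
  σ̂-homogeneous : Homogeneous n (suc k) (hadamard (signs f))
  σ̂-homogeneous = hadamard-signs-homogeneous f kf
  σ̂-divisible : ∃[ y ] hadamard (signs f) ≡ c ⊙ y
  σ̂-divisible = hadamard-signs-divisible k e f (homogeneous⇒degreeBelow n (suc k) _ σ̂-homogeneous)
  y : IntFun n
  y = proj₁ σ̂-divisible
  σ̂≡c⊙y : hadamard (signs f) ≡ c ⊙ y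
  σ̂≡c⊙y = proj₂ σ̂-divisible
  parseval : c ℤ.* (c ℤ.* ‖ y ‖²) ≡ c ℤ.* (c ℤ.* + (4 ^ k))
  parseval = begin
    c ℤ.* (c ℤ.* ‖ y ‖²)
      ≡⟨ sym (‖⊙‖² c y) ⟩
    ‖ c ⊙ y ‖²
      ≡⟨ cong ‖_‖² (sym σ̂≡c⊙y) ⟩
    ‖ hadamard (signs f) ‖²
      ≡⟨ ‖hadamard‖² (signs f) ⟩
    + (2 ^ n) ℤ.* ‖ signs f ‖²
      ≡⟨ cong (+ (2 ^ n) ℤ.*_) (‖signs‖² f) ⟩
    + (2 ^ n) ℤ.* + (2 ^ n)
      ≡⟨ cong₂ ℤ._*_ (+2^[1+k+e]≡+2^[1+e]*+2^k k e) (+2^[1+k+e]≡+2^[1+e]*+2^k k e) ⟩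
    (c ℤ.* + (2 ^ k)) ℤ.* (c ℤ.* + (2 ^ k))
      ≡⟨ regroup c (+ (2 ^ k)) ⟩
    c ℤ.* (c ℤ.* (+ (2 ^ k) ℤ.* + (2 ^ k)))
      ≡⟨ cong (λ a → c ℤ.* (c ℤ.* a)) (sym (ℤP.pos-* (2 ^ k) (2 ^ k))) ⟩
    c ℤ.* (c ℤ.* + (2 ^ k ℕ.* 2 ^ k))
      ≡⟨ cong (λ a → c ℤ.* (c ℤ.* + a)) (sym (4^k≡2^k*2^k k)) ⟩
    c ℤ.* (c ℤ.* + (4 ^ k)) ∎
    where
    regroup : ∀ a b → (a ℤ.* b) ℤ.* (a ℤ.* b) ≡ a ℤ.* (a ℤ.* (b ℤ.* b))
    regroup = solve-∀
  ‖y‖²≡ : ‖ y ‖² ≡ + (4 ^ k)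
  ‖y‖²≡ = ℤP.*-cancelˡ-≡ c _ _ (ℤP.*-cancelˡ-≡ c _ _ parseval)

binomial : ℕ → ℕ → ℕ
binomial n       zero    = 1
binomial zero    (suc k) = 0
binomial (suc n) (suc k) = binomial n k + binomial n (suc k)

binomial≡C : ∀ n k → binomial n k ≡ n C k
binomial≡C n       zero    = refl
binomial≡C zero    (suc k) = refl
binomial≡C (suc n) (suc k) =
  trans (cong₂ _+_ (binomial≡C n k) (binomial≡C n (suc k))) (nCk+nC[k+1]≡[n+1]C[k+1] n k)

levelCoefficients : ∀ {n} k → IntFun n → Vec ℤ (binomial n k)
levelCoefficients {zero}  zero    a       = a ∷ []
levelCoefficients {zero}  (suc k) a       = []
levelCoefficients {suc n} zero    (a , b) = levelCoefficients zero a
levelCoefficients {suc n} (suc k) (a , b) = levelCoefficients k b Vec.++ levelCoefficients (suc k) a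

sumSq-++ : ∀ {s t} (xs : Vec ℤ s) (ys : Vec ℤ t) → sumSq (xs Vec.++ ys) ≡ sumSq xs ℤ.+ sumSq ys
sumSq-++ []       ys = sym (ℤP.+-identityˡ (sumSq ys))
sumSq-++ (x ∷ xs) ys = trans (cong (ℤ._+_ (x ℤ.* x)) (sumSq-++ xs ys)) (sym (ℤP.+-assoc (x ℤ.* x) _ _))

sumSq-levelCoefficients : ∀ n k (u : IntFun n) → Homogeneous n k u → sumSq (levelCoefficients k u) ≡ ‖ u ‖²
sumSq-levelCoefficients zero    zero    a       _         = ℤP.+-identityʳ (a ℤ.* a)
sumSq-levelCoefficients zero    (suc k) a       refl      = refl
sumSq-levelCoefficients (suc n) zero    (a , b) (ha , refl) = begin
  sumSq (levelCoefficients zero a) ≡⟨ sumSq-levelCoefficients n zero a ha ⟩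
  ‖ a ‖²                           ≡⟨ sym (ℤP.+-identityʳ ‖ a ‖²) ⟩
  ‖ a ‖² ℤ.+ + 0                   ≡⟨ cong (ℤ._+_ ‖ a ‖²) (sym (‖𝟘‖² n)) ⟩
  ‖ a ‖² ℤ.+ ‖ 𝟘 {n} ‖² ∎
  where
  open ≡-Reasoning
  ‖𝟘‖² : ∀ n → ‖ 𝟘 {n} ‖² ≡ + 0
  ‖𝟘‖² zero    = refl
  ‖𝟘‖² (suc n) = cong₂ ℤ._+_ (‖𝟘‖² n) (‖𝟘‖² n)
sumSq-levelCoefficients (suc n) (suc k) (a , b) (ha , hb) = begin
  sumSq (levelCoefficients k b Vec.++ levelCoefficients (suc k) a)
    ≡⟨ sumSq-++ (levelCoefficients k b) (levelCoefficients (suc k) a) ⟩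
  sumSq (levelCoefficients k b) ℤ.+ sumSq (levelCoefficients (suc k) a)
    ≡⟨ cong₂ ℤ._+_ (sumSq-levelCoefficients n k b hb) (sumSq-levelCoefficients n (suc k) a ha) ⟩
  ‖ b ‖² ℤ.+ ‖ a ‖²
    ≡⟨ ℤP.+-comm ‖ b ‖² ‖ a ‖² ⟩
  ‖ a ‖² ℤ.+ ‖ b ‖² ∎
  where open ≡-Reasoning

levelCoefficients-injective : ∀ n k (u u′ : IntFun n) → Homogeneous n k u → Homogeneous n k u′ →
                              levelCoefficients k u ≡ levelCoefficients k u′ → u ≡ u′
levelCoefficients-injective zero    zero    a a′ _ _ eq = VecP.∷-injectiveˡ eq
levelCoefficients-injective zero    (suc k) a a′ a≡0 a′≡0 _ = trans a≡0 (sym a′≡0)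
levelCoefficients-injective (suc n) zero    (a , b) (a′ , b′) (ha , b≡𝟘) (ha′ , b′≡𝟘) eq =
  cong₂ _,_ (levelCoefficients-injective n zero a a′ ha ha′ eq) (trans b≡𝟘 (sym b′≡𝟘))
levelCoefficients-injective (suc n) (suc k) (a , b) (a′ , b′) (ha , hb) (ha′ , hb′) eq =
  cong₂ _,_ (levelCoefficients-injective n (suc k) a a′ ha ha′ (VecP.++-injectiveʳ (levelCoefficients k b) _ eq))
            (levelCoefficients-injective n k b b′ hb hb′ (VecP.++-injectiveˡ (levelCoefficients k b) _ eq))

∣_∣² : ℤ → ℕ
∣ a ∣² = ∣ a ∣ ℕ.* ∣ a ∣

a*a≡+∣a∣² : ∀ a → a ℤ.* a ≡ + ∣ a ∣²
a*a≡+∣a∣² (+ n)    = ℤP.+◃n≡+n (n ℕ.* n)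
a*a≡+∣a∣² -[1+ n ] = refl

sumSqℕ : ∀ {t} → Vec ℤ t → ℕ
sumSqℕ []       = 0
sumSqℕ (a ∷ xs) = ∣ a ∣² + sumSqℕ xs

sumSq≡+sumSqℕ : ∀ {t} (xs : Vec ℤ t) → sumSq xs ≡ + sumSqℕ xs
sumSq≡+sumSqℕ []       = refl
sumSq≡+sumSqℕ (a ∷ xs) =
  trans (cong₂ ℤ._+_ (a*a≡+∣a∣² a) (sumSq≡+sumSqℕ xs)) (sym (ℤP.pos-+ ∣ a ∣² (sumSqℕ xs)))

∈-intRange : ∀ {q} a → ∣ a ∣ ≤ q → a ∈ intRange q
∈-intRange (+ zero)    _  = here refl
∈-intRange (+ suc j)   le = there (∈-concatMap⁺ _ (Any.map (λ { refl → here refl }) (∈-upTo⁺ le)))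
∈-intRange -[1+ j ]    le = there (∈-concatMap⁺ _ (Any.map (λ { refl → there (here refl) }) (∈-upTo⁺ le)))

∈-boxVecs : ∀ {q t} (xs : Vec ℤ t) → sumSqℕ xs ≤ q → xs ∈ boxVecs q t
∈-boxVecs []           _  = here refl
∈-boxVecs {q} {suc t} (a ∷ xs) le = ∈-concatMap⁺ _ (Any.map (λ { refl → ∈-map⁺ (a ∷_) xs∈ }) a∈)
  where
  ∣a∣≤∣a∣² : ∣ a ∣ ≤ ∣ a ∣²
  ∣a∣≤∣a∣² with ∣ a ∣
  ... | zero  = z≤n
  ... | suc m = ℕP.m≤m*n (suc m) (suc m)
  xs∈ : xs ∈ boxVecs q t
  xs∈ = ∈-boxVecs xs (ℕP.≤-trans (ℕP.m≤n+m (sumSqℕ xs) ∣ a ∣²) le)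
  a∈ : a ∈ intRange q
  a∈ = ∈-intRange a (ℕP.≤-trans ∣a∣≤∣a∣² (ℕP.≤-trans (ℕP.m≤m+n ∣ a ∣² (sumSqℕ xs)) le))

sumSq≡⇒∈boxVecs : ∀ {q t} (xs : Vec ℤ t) → sumSq xs ≡ + q → xs ∈ boxVecs q t
sumSq≡⇒∈boxVecs xs eq = ∈-boxVecs xs (ℕP.≤-reflexive (ℤP.+-injective (trans (sym (sumSq≡+sumSqℕ xs)) eq)))

module _ {a b ℓ r : Level} (S : Setoid a ℓ) {B : Set b} (R : Setoid.Carrier S → B → Set r) where
  open Setoid S using (_≈_)

  length≤-of-injectiveRelation : (∀ {x x′ y} → R x y → R x′ y → x ≈ x′) →
    ∀ {xs ys} → Unique S xs → (∀ {x} → x ∈ xs → ∃[ y ] y ∈ ys × R x y) → length xs ≤ length ys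
  length≤-of-injectiveRelation inj {[]}     _            _   = z≤n
  length≤-of-injectiveRelation inj {x ∷ xs} (x≉xs ∷ xs!) img with img (here refl)
  ... | y , y∈ys , Rxy with ∈-∃++ y∈ys
  ... | ys₁ , ys₂ , refl =
    ℕP.≤-trans (s≤s (length≤-of-injectiveRelation inj xs! img′))
               (ℕP.≤-reflexive (sym (ListP.length-++-sucʳ ys₁ y ys₂)))
    where
    drop-y : ∀ {y′} → y′ ∈ ys₁ ++ y ∷ ys₂ → y′ ≢ y → y′ ∈ ys₁ ++ ys₂
    drop-y y′∈ y′≢y with ∈-++⁻ ys₁ y′∈
    ... | inj₁ y′∈ys₁           = ∈-++⁺ˡ y′∈ys₁
    ... | inj₂ (here y′≡y)      = ⊥-elim (y′≢y y′≡y)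
    ... | inj₂ (there y′∈ys₂)   = ∈-++⁺ʳ ys₁ y′∈ys₂
    img′ : ∀ {x′} → x′ ∈ xs → ∃[ y′ ] y′ ∈ ys₁ ++ ys₂ × R x′ y′
    img′ x′∈xs with img (there x′∈xs)
    ... | y′ , y′∈ys , Rx′y′ =
      y′ , drop-y y′∈ys (λ { refl → All.lookup x≉xs x′∈xs (inj Rxy Rx′y′) }) , Rx′y′

BoolFunSetoid : ℕ → Setoid _ _
BoolFunSetoid n = Vertex n →-setoid Bool

concatMap-map≡cartesianProductWith : ∀ {A B C : Set} (f : A → B → C) xs ys →
  concatMap (λ x → map (f x) ys) xs ≡ cartesianProductWith f xs ys
concatMap-map≡cartesianProductWith f []       ys = refl
concatMap-map≡cartesianProductWith f (x ∷ xs) ys = cong (map (f x) ys ++_) (concatMap-map≡cartesianProductWith f xs ys)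

allBoolFuns-unique : ∀ n → Unique (BoolFunSetoid n) (allBoolFuns n)
allBoolFuns-unique zero    = ((λ f≗g → case f≗g [] of λ ()) ∷ []) ∷ [] ∷ []
allBoolFuns-unique (suc n) =
  subst (Unique (BoolFunSetoid (suc n))) (sym (concatMap-map≡cartesianProductWith _ (allBoolFuns n) (allBoolFuns n)))
    (UniqueP.cartesianProductWith⁺ (BoolFunSetoid n) (BoolFunSetoid n) (BoolFunSetoid (suc n)) _
      (λ eq → eq ∘ (false ∷_) , eq ∘ (true ∷_)) (allBoolFuns-unique n) (allBoolFuns-unique n))

∈-allVertices : ∀ n (v : Vertex n) → v ∈ allVertices n
∈-allVertices zero    []          = here refl
∈-allVertices (suc n) (false ∷ v) = ∈-concatMap⁺ _ (Any.map (λ { refl → here refl }) (∈-allVertices n v))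
∈-allVertices (suc n) (true  ∷ v) = ∈-concatMap⁺ _ (Any.map (λ { refl → there (here refl) }) (∈-allVertices n v))

isKFunctionOn⇒isKFunction : ∀ {n k} (f : BoolFun n) → IsKFunctionOn n k f → IsKFunction n k f
isKFunctionOn⇒isKFunction {n} f kf v = All.lookup kf (∈-allVertices n v)

kFunctions≤sumsOfSquares : ∀ k e → F (suc k + e) (suc k) ≤ S (4 ^ k) (binomial (suc k + e) (suc k))
kFunctions≤sumsOfSquares k e =
  length≤-of-injectiveRelation (BoolFunSetoid n) Encodes encodes-injective
    (UniqueP.filter⁺ (BoolFunSetoid n) (isKFunction? n (suc k)) (allBoolFuns-unique n)) encoding
  where
  n : ℕ
  n = suc k + e
  Encodes : BoolFun n → Vec ℤ (binomial n (suc k)) → Set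
  Encodes f x = ∃[ y ] Homogeneous n (suc k) y × hadamard (signs f) ≡ + (2 ^ suc e) ⊙ y ×
                       levelCoefficients (suc k) y ≡ x
  encodes-injective : ∀ {f g x} → Encodes f x → Encodes g x → ∀ v → f v ≡ g v
  encodes-injective {f} {g} (y , hy , σ̂f≡ , yx) (y′ , hy′ , σ̂g≡ , y′x) =
    signs-injective f g (hadamard-injective (signs f) (signs g)
      (trans σ̂f≡ (trans (cong (+ (2 ^ suc e) ⊙_) y≡y′) (sym σ̂g≡))))
    where
    y≡y′ : y ≡ y′
    y≡y′ = levelCoefficients-injective n (suc k) y y′ hy hy′ (trans yx (sym y′x))
  solutions : List (Vec ℤ (binomial n (suc k)))
  solutions = filter (λ x → sumSq x ℤP.≟ + (4 ^ k)) (boxVecs (4 ^ k) (binomial n (suc k)))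
  encoding : ∀ {f} → f ∈ filter (isKFunction? n (suc k)) (allBoolFuns n) → ∃[ x ] x ∈ solutions × Encodes f x
  encoding {f} f∈ =
    let kf = isKFunctionOn⇒isKFunction f (proj₂ (∈-filter⁻ (isKFunction? n (suc k)) {xs = allBoolFuns n} f∈))
        y , hy , σ̂≡ , ‖y‖²≡ = kFunction-scaledSpectrum k e f kf
        sumSq≡ = trans (sumSq-levelCoefficients n (suc k) y hy) ‖y‖²≡
    in  levelCoefficients (suc k) y ,
        ∈-filter⁺ (λ x → sumSq x ℤP.≟ + (4 ^ k)) (sumSq≡⇒∈boxVecs _ sumSq≡) sumSq≡ ,
        (y , hy , σ̂≡ , refl)

lemma8 : (n k : ℕ) → 1 ≤ k → k ≤ n → F n k ≤ S (4 ^ (k ∸ 1)) (n C k)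
lemma8 n (suc k) _ k≤n with e , refl ← ℕP.m≤n⇒∃[o]m+o≡n k≤n =
  subst (λ t → F (suc k + e) (suc k) ≤ S (4 ^ k) t) (binomial≡C (suc k + e) (suc k)) (kFunctions≤sumsOfSquares k e)
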